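{- Let $\mathcal M_V=(\Sigma_V,\preccurlyeq_{\Sigma_V},s_{\Sigma_V})$ and $\mathcal M_E=(\Sigma_E,\preccurlyeq_{\Sigma_E},s_{\Sigma_E})$ be Maximum Common Subelement (MCS) Models whose size functions are strictly positive ($s_{\Sigma_V}>0$, $s_{\Sigma_E}>0$). Let $G$ be the set of graphs with vertex labels in $\Sigma_V$ and edge labels in $\Sigma_E$, where isomorphic graphs are regarded as the same element of $G$. Let $\subseteq_e$ be the extended-subgraph-isomorphic relation on $G$ with respect to $\preccurlyeq_{\Sigma_V}$ and $\preccurlyeq_{\Sigma_E}$, and define $s_{GES}:G\to[0,\infty)$ by $s_{GES}(g)=0$ if $V=\emptyset$ and otherwise $s_{GES}(g)=\sum_{v\in V}s_{\Sigma_V}(\ell_V(v))+\sum_{e\in E}s_{\Sigma_E}(\ell_E(e))$ for $g=(V,E,\ell_V,\ell_E)$. Then $(G,\subseteq_e,s_{GES})$ is an MCS Model.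
   Context: A graph is a 4-tuple $g=(V,E,\ell_V,\ell_E)$ with $V$ a finite set, $E\subseteq[V]^2$ (the set of 2-element subsets of $V$), $\ell_V:V\to\Sigma_V$, $\ell_E:E\to\Sigma_E$; it is empty if $V=\emptyset$. An isomorphism between $g_1$ and $g_2$ is a bijection $\phi:V_1\to V_2$ with $E_2=\{\{\phi(u),\phi(v)\}:\{u,v\}\in E_1\}$, $\ell_{V_1}(v)=\ell_{V_2}(\phi(v))$ and $\ell_{E_1}(\{u,v\})=\ell_{E_2}(\{\phi(u),\phi(v)\})$. $g'=(V',E',\ell'_V,\ell'_E)$ is an extended subgraph of $g=(V,E,\ell_V,\ell_E)$ (w.r.t. $\preccurlyeq_{\Sigma_V},\preccurlyeq_{\Sigma_E}$) if $V'\subseteq V$, $E'\subseteq E\cap[V']^2$, $\ell'_V(v)\preccurlyeq_{\Sigma_V}\ell_V(v)$ for $v\in V'$ and $\ell'_E(e)\preccurlyeq_{\Sigma_E}\ell_E(e)$ for $e\in E'$. $g'\subseteq_e g$ means $g'$ is isomorphic to some extended subgraph of $g$. For a partial order $\preccurlyeq$ on $X$ and $X'\subseteq X$, $cs(X')=\{x\in X: x\preccurlyeq y\ \forall y\in X'\}$. A size function on $(X,\preccurlyeq)$ is $s:X\to[0,\infty)$ with (S1) $x_1\preccurlyeq x_2\Rightarrow s(x_1)\le s(x_2)$ and (S2) $x_1\preccurlyeq x_2$, $s(x_1)=s(x_2)\Rightarrow x_1=x_2$. An MCS Model is a triple $(X,\preccurlyeq,s)$ with $\preccurlyeq$ a partial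 order on $X$, $s$ a size function, and (A1) for all $x_1,x_2$, $cs(\{x_1,x_2\})\ne\emptyset$ and $\{s(x)\mid x\in cs(\{x_1,x_2\})\}$ has a maximum; (A2) for all $x_1,x_2,x$ with $x_1,x_2\preccurlyeq x$ there is $x_{12}\in cs(\{x_1,x_2\})$ with $s(x)\ge s(x_1)+s(x_2)-s(x_{12})$. -}

module Defs where

open import Level using (0ℓ)
open import Data.Nat using (ℕ; zero; suc; _<ᵇ_)
open import Data.Fin using (Fin; toℕ)
open import Data.Maybe using (Maybe; just; nothing)
open import Data.Bool using (if_then_else_)
open import Data.Product using (Σ; _×_; ∃)
open import Data.Sum using (_⊎_)
open import Function.Bundles using (_↔_; _↣_; Inverse; Injection)
open import Relation.Binary.Core using (Rel)
open import Relation.Binary.Structures using (IsTotalOrder; IsPartialOrder)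
open import Relation.Binary.PropositionalEquality using (_≡_; _≢_)
open import Algebra.Structures using (IsCommutativeRing)

-- The real numbers, axiomatised as a complete ordered field.
-- (agda-stdlib has no reals; any two models of this record are
-- isomorphic, so quantifying over all of them is faithful.)

record Reals : Set₁ where
  infixl 6 _+_ _-_
  infixl 7 _*_
  infix 4 _≤_ _<_
  field
    ℝ   : Set
    _+_ _*_ : ℝ → ℝ → ℝ
    -_  : ℝ → ℝ
    0# 1# : ℝ
    _≤_ : ℝ → ℝ → Set
    isCommutativeRing : IsCommutativeRing _≡_ _+_ _*_ -_ 0# 1#
    0≢1   : 0# ≢ 1#
    inv   : ∀ x → x ≢ 0# → Σ ℝ λ y → x * y ≡ 1#
    isTotalOrder : IsTotalOrder _≡_ _≤_
    +-mono-≤ : ∀ {x y} z → x ≤ y → x + z ≤ y + z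
    *-nonneg : ∀ {x y} → 0# ≤ x → 0# ≤ y → 0# ≤ x * y
    complete : (P : ℝ → Set) → ∃ P →
               (Σ ℝ λ b → ∀ x → P x → x ≤ b) →
               Σ ℝ λ u → (∀ x → P x → x ≤ u) ×
                         (∀ b → (∀ x → P x → x ≤ b) → u ≤ b)

  _-_ : ℝ → ℝ → ℝ
  x - y = x + (- y)

  _<_ : ℝ → ℝ → Set
  x < y = (x ≤ y) × (x ≢ y)

-- The carrier X comes with an equality _≈_ (for plain
-- label alphabets this is _≡_; for graphs it is isomorphism, which
-- models "isomorphic graphs are regarded as the same element").

module _ (R : Reals) where
  open Reals R

  CS : {X : Set} → Rel X 0ℓ → X → X → X → Set
  CS _≼_ x₁ x₂ x = (x ≼ x₁) × (x ≼ x₂)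

  record IsMCSModel {X : Set} (_≈_ _≼_ : Rel X 0ℓ) (s : X → ℝ) : Set where
    field
      isPartialOrder : IsPartialOrder _≈_ _≼_
      s-resp  : ∀ {x y} → x ≈ y → s x ≡ s y
      s-nonneg : ∀ x → 0# ≤ s x
      S1 : ∀ {x₁ x₂} → x₁ ≼ x₂ → s x₁ ≤ s x₂
      S2 : ∀ {x₁ x₂} → x₁ ≼ x₂ → s x₁ ≡ s x₂ → x₁ ≈ x₂
      A1 : ∀ x₁ x₂ → Σ X λ m → CS _≼_ x₁ x₂ m ×
                                (∀ y → CS _≼_ x₁ x₂ y → s y ≤ s m)
      A2 : ∀ x₁ x₂ x → x₁ ≼ x → x₂ ≼ x →
           Σ X λ x₁₂ → CS _≼_ x₁ x₂ x₁₂ × (s x₁ + s x₂ - s x₁₂ ≤ s x)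

-- The vertex set is Fin n (every finite set is in
-- bijection with some Fin n, and graphs are considered up to
-- isomorphism).  E ⊆ [V]² together with ℓ_E is encoded by a symmetric,
-- irreflexive function  el : V → V → Maybe Σ_E  :  {u,v} ∈ E iff
-- el u v = just (ℓ_E {u,v}).

record Graph (ΣV ΣE : Set) : Set where
  field
    n     : ℕ
    vl    : Fin n → ΣV
    el    : Fin n → Fin n → Maybe ΣE
    sym   : ∀ u v → el u v ≡ el v u
    irrefl : ∀ v → el v v ≡ nothing
open Graph public

module _ {ΣV ΣE : Set} where

  _≅_ : Graph ΣV ΣE → Graph ΣV ΣE → Set
  g₁ ≅ g₂ = Σ (Fin (n g₁) ↔ Fin (n g₂)) λ φ →
              (∀ v → vl g₁ v ≡ vl g₂ (Inverse.to φ v)) ×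
              (∀ u v → el g₁ u v ≡ el g₂ (Inverse.to φ u) (Inverse.to φ v))

  module _ (_≼V_ : Rel ΣV 0ℓ) (_≼E_ : Rel ΣE 0ℓ) where

    -- h is an extended subgraph of g.  V' ⊆ V is represented by an
    -- injective map ι : V' ↣ V (the inclusion); E' ⊆ E ∩ [V']² and
    -- the label conditions are required along ι.
    ExtSubgraph : Graph ΣV ΣE → Graph ΣV ΣE → Set
    ExtSubgraph h g = Σ (Fin (n h) ↣ Fin (n g)) λ ι →
      (∀ v → vl h v ≼V vl g (Injection.to ι v)) ×
      (∀ u v → (el h u v ≡ nothing) ⊎
               (Σ ΣE λ a → Σ ΣE λ b →
                  (el h u v ≡ just a) ×
                  (el g (Injection.to ι u) (Injection.to ι v) ≡ just b) ×
                  (a ≼E b)))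

    _⊆e_ : Graph ΣV ΣE → Graph ΣV ΣE → Set
    g' ⊆e g = Σ (Graph ΣV ΣE) λ h → (g' ≅ h) × ExtSubgraph h g

  module _ (R : Reals) (sV : ΣV → Reals.ℝ R) (sE : ΣE → Reals.ℝ R) where
    open Reals R

    sumFin : (k : ℕ) → (Fin k → ℝ) → ℝ
    sumFin zero    f = 0#
    sumFin (suc k) f = f Fin.zero + sumFin k (λ i → f (Fin.suc i))

    edgeWeight : Maybe ΣE → ℝ
    edgeWeight nothing  = 0#
    edgeWeight (just a) = sE a

    -- s_GES(g) = 0 if V = ∅, else Σ_v sV(ℓ_V v) + Σ_{e∈E} sE(ℓ_E e)
    -- (each unordered edge {u,v} counted once, via u < v)
    sGES : Graph ΣV ΣE → ℝ
    sGES g with n g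
    ... | zero  = 0#
    ... | suc _ =
      sumFin (n g) (λ v → sV (vl g v)) +
      sumFin (n g) (λ u → sumFin (n g) (λ v →
        if toℕ u <ᵇ toℕ v then edgeWeight (el g u v) else 0#))

-- Twice s_GES is the weight 2·Σ_v s(ℓ_V v) + Σ_{(u,v)} s(ℓ_E {u,v}), summed over vertices and
-- ordered pairs of vertices. An extended subgraph h of g, read as an injection V_h → V_g, pushes
-- the vertex and edge sizes of h forward to sizes on V_g that lie pointwise below those of g;
-- this gives (S1), and (S2) because vertex sizes are positive. Adding "no edge" as a bottom
-- element of size 0 turns the edge labels into another MCS model, so edges are handled exactly
-- like vertices, through the meet of maximal size that (A1) provides for the label models.
-- For (A2), the common part of x₁, x₂ ⊆ x is the meet graph on the vertices of x hit by both
-- embeddings, and the inequality holds pointwise on the vertices of x. For (A1), every common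
-- subgraph of x₁ and x₂ is dominated by the meet graph of the partial injection V_{x₁} ⇀ V_{x₂}
-- it induces; as there are finitely many partial maps, one of them yields a largest common
-- subgraph.

module Submission where

open import Level using (0ℓ)
open import Algebra.Bundles using (CommutativeRing; AbelianGroup)
import Algebra.Properties.CommutativeMonoid.Sum as CommutativeMonoidSum
import Algebra.Properties.CommutativeSemigroup as CommutativeSemigroupProperties
import Algebra.Properties.Group as GroupProperties
open import Data.Bool using (true; false; if_then_else_)
open import Data.Empty using (⊥-elim)
open import Data.Fin using (Fin; zero; suc; punchIn; toℕ)
open import Data.Fin.Properties using (_≟_; any?; all?; punchInᵢ≢i; suc-injective; toℕ-injective)
open import Data.Maybe using (Maybe; just; nothing)
open import Data.Maybe.Properties using (≡-dec; just-injective)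
open import Data.Nat using (ℕ; zero; suc; _<ᵇ_)
open import Data.Nat.Properties using (<ᵇ-reflects-<; <-asym; ≮⇒≥) renaming (≤-antisym to ℕ-≤-antisym)
open import Data.Product using (Σ; _×_; _,_; proj₁; proj₂; ∃)
import Data.Product as Product
open import Data.Sum using (_⊎_; inj₁; inj₂)
import Data.Sum as Sum
open import Data.Vec using (Vec; []; _∷_; lookup; tabulate)
open import Data.Vec.Properties using (lookup∘tabulate)
open import Function.Base using (_∘_)
open import Function.Bundles using (Injection; Inverse; _↔_; mk↣; mk↔ₛ′)
open import Function.Definitions using (Injective)
open import Function.Properties.Inverse using (↔-refl; ↔-sym; ↔-trans; ↔⇒↣)
open import Relation.Binary.Core using (Rel)
open import Relation.Binary.PropositionalEquality
  using (_≡_; _≢_; refl; sym; trans; cong; cong₂; subst; subst₂; isEquivalence; module ≡-Reasoning)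
open import Relation.Binary.Structures using (IsTotalOrder; IsPartialOrder)
open import Relation.Nullary using (Dec; yes; no; ¬_)
open import Relation.Nullary.Decidable using (_→-dec_)
open import Relation.Nullary.Reflects using (ofʸ; ofⁿ)

open import Defs hiding (sym)

module RealProperties (R : Reals) where
  open Reals R public renaming (+-mono-≤ to +-monoˡ-≤)
  open IsTotalOrder isTotalOrder public using (total)
    renaming (refl to ≤-refl; reflexive to ≤-reflexive; trans to ≤-trans; antisym to ≤-antisym)

  commutativeRing : CommutativeRing 0ℓ 0ℓ
  commutativeRing = record { isCommutativeRing = isCommutativeRing }

  open CommutativeRing commutativeRing public
    using (+-comm; +-identityˡ; +-identityʳ; +-commutativeMonoid; +-abelianGroup)
  open GroupProperties (AbelianGroup.group +-abelianGroup) public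
    using (∙-cancelʳ; \\-leftDividesʳ; //-rightDividesˡ; //-rightDividesʳ)
  open CommutativeRing commutativeRing public using (+-commutativeSemigroup)
  open CommutativeSemigroupProperties +-commutativeSemigroup public using (interchange)
  open CommutativeMonoidSum +-commutativeMonoid public
    using (sum; ∑-distrib-+; ∑-comm; sum-cong-≗; sum-replicate-zero; sum-remove)

  ≤-respˡ-≡ : ∀ {x y z} → x ≡ y → x ≤ z → y ≤ z
  ≤-respˡ-≡ refl x≤z = x≤z

  ≤-respʳ-≡ : ∀ {x y z} → y ≡ z → x ≤ y → x ≤ z
  ≤-respʳ-≡ refl x≤y = x≤y

  +-monoʳ-≤ : ∀ z {x y} → x ≤ y → z + x ≤ z + y
  +-monoʳ-≤ z {x} {y} x≤y = subst₂ _≤_ (+-comm x z) (+-comm y z) (+-monoˡ-≤ z x≤y)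

  +-mono-≤ : ∀ {a b c d} → a ≤ b → c ≤ d → a + c ≤ b + d
  +-mono-≤ {b = b} {c = c} a≤b c≤d = ≤-trans (+-monoˡ-≤ c a≤b) (+-monoʳ-≤ b c≤d)

  +-cancelˡ-≤ : ∀ a {c d} → a + c ≤ a + d → c ≤ d
  +-cancelˡ-≤ a {c} {d} a+c≤a+d =
    subst₂ _≤_ (\\-leftDividesʳ a c) (\\-leftDividesʳ a d) (+-monoʳ-≤ (- a) a+c≤a+d)

  +-mono-≤-tight : ∀ {a b c d} → a ≤ b → c ≤ d → a + c ≡ b + d → a ≡ b × c ≡ d
  +-mono-≤-tight {a} {b} {c} {d} a≤b c≤d a+c≡b+d =
    ∙-cancelʳ c a b (trans a+c≡b+d (cong (b +_) (sym c≡d))) , c≡d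
    where
    c≡d : c ≡ d
    c≡d = ≤-antisym c≤d (+-cancelˡ-≤ a (≤-trans (+-monoˡ-≤ d a≤b) (≤-reflexive (sym a+c≡b+d))))

  x+x≤y+y⇒x≤y : ∀ {x y} → x + x ≤ y + y → x ≤ y
  x+x≤y+y⇒x≤y {x} {y} p with total x y
  ... | inj₁ x≤y = x≤y
  ... | inj₂ y≤x = ≤-reflexive (sym (proj₁ (+-mono-≤-tight y≤x y≤x y+y≡x+x)))
    where
    y+y≡x+x : y + y ≡ x + x
    y+y≡x+x = ≤-antisym (+-mono-≤ y≤x y≤x) p

  x≤y+z⇒x-z≤y : ∀ {x y z} → x ≤ y + z → x - z ≤ y
  x≤y+z⇒x-z≤y {x} {y} {z} p = subst (x - z ≤_) (//-rightDividesʳ z y) (+-monoˡ-≤ (- z) p)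

  x-z≤y⇒x≤y+z : ∀ {x y z} → x - z ≤ y → x ≤ y + z
  x-z≤y⇒x≤y+z {x} {y} {z} p = subst (_≤ y + z) (//-rightDividesˡ z x) (+-monoˡ-≤ z p)

  +-≤-+0 : ∀ {a b c} → a ≤ c → b ≤ c → a ≡ 0# ⊎ b ≡ 0# → a + b ≤ c + 0#
  +-≤-+0 {b = b} _ b≤c (inj₁ refl) = subst₂ _≤_ (sym (+-identityˡ b)) (sym (+-identityʳ _)) b≤c
  +-≤-+0 {a = a} a≤c _ (inj₂ refl) = subst₂ _≤_ (sym (+-identityʳ a)) (sym (+-identityʳ _)) a≤c

  sum-mono-≤ : ∀ {k} {f g : Fin k → ℝ} → (∀ i → f i ≤ g i) → sum f ≤ sum g
  sum-mono-≤ {zero} _ = ≤-refl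
  sum-mono-≤ {suc k} f≤g = +-mono-≤ (f≤g zero) (sum-mono-≤ (λ i → f≤g (suc i)))

  sum-zero : ∀ {k} {f : Fin k → ℝ} → (∀ i → f i ≡ 0#) → sum f ≡ 0#
  sum-zero {k} f≗0 = trans (sum-cong-≗ f≗0) (sum-replicate-zero k)

  sum-nonneg : ∀ {k} {f : Fin k → ℝ} → (∀ i → 0# ≤ f i) → 0# ≤ sum f
  sum-nonneg {k} {f} 0≤f = subst (_≤ sum f) (sum-replicate-zero k) (sum-mono-≤ {f = λ _ → 0#} 0≤f)

  sum-single : ∀ {k} {f : Fin k → ℝ} i → (∀ j → j ≢ i → f j ≡ 0#) → sum f ≡ f i
  sum-single {suc _} {f} i f≗0 = trans (sum-remove {i = i} f)
    (trans (cong (f i +_) (sum-zero (λ j → f≗0 (punchIn i j) (punchInᵢ≢i i j)))) (+-identityʳ (f i)))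

  sum-mono-≤-tight : ∀ {k} {f g : Fin k → ℝ} → (∀ i → f i ≤ g i) →
                     sum f ≡ sum g → ∀ i → f i ≡ g i
  sum-mono-≤-tight {suc k} f≤g Σf≡Σg
    with +-mono-≤-tight (f≤g zero) (sum-mono-≤ (λ i → f≤g (suc i))) Σf≡Σg
  ... | f0≡g0 , rest≡ = λ { zero → f0≡g0 ; (suc i) → sum-mono-≤-tight (λ i → f≤g (suc i)) rest≡ i }

module Argmax (R : Reals) where
  open RealProperties R

  HasArgmax : Set → Set
  HasArgmax A = (f : A → ℝ) → Σ A λ a* → ∀ a → f a ≤ f a*

  fin-hasArgmax : ∀ m → HasArgmax (Fin (suc m))
  fin-hasArgmax zero    f = zero , λ { zero → ≤-refl }
  fin-hasArgmax (suc m) f with fin-hasArgmax m (λ i → f (suc i))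
  ... | i* , f∘suc≤ with total (f zero) (f (suc i*))
  ...   | inj₁ f0≤ = suc i* , λ { zero → f0≤ ; (suc i) → f∘suc≤ i }
  ...   | inj₂ ≤f0 = zero , λ { zero → ≤-refl ; (suc i) → ≤-trans (f∘suc≤ i) ≤f0 }

  maybeFin-hasArgmax : ∀ m → HasArgmax (Maybe (Fin m))
  maybeFin-hasArgmax m f with fin-hasArgmax m (λ i → f (toMaybe i))
    where
    toMaybe : Fin (suc m) → Maybe (Fin m)
    toMaybe zero    = nothing
    toMaybe (suc i) = just i
  ... | zero  , ≤f* = nothing , λ { nothing → ≤f* zero ; (just i) → ≤f* (suc i) }
  ... | suc j , ≤f* = just j  , λ { nothing → ≤f* zero ; (just i) → ≤f* (suc i) }

  vec-hasArgmax : ∀ {A} k → HasArgmax A → HasArgmax (Vec A k)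
  vec-hasArgmax zero    _       f = [] , λ { [] → ≤-refl }
  vec-hasArgmax {A} (suc k) argmaxA f =
    (a* ∷ bestTail a*) , λ { (a ∷ as) → ≤-trans (bestTail-≥ a as) (a*-≥ a) }
    where
    bestTail : A → Vec A k
    bestTail a = proj₁ (vec-hasArgmax k argmaxA (λ as → f (a ∷ as)))
    bestTail-≥ : ∀ a as → f (a ∷ as) ≤ f (a ∷ bestTail a)
    bestTail-≥ a = proj₂ (vec-hasArgmax k argmaxA (λ as → f (a ∷ as)))
    a* : A
    a* = proj₁ (argmaxA (λ a → f (a ∷ bestTail a)))
    a*-≥ : ∀ a → f (a ∷ bestTail a) ≤ f (a* ∷ bestTail a*)
    a*-≥ = proj₂ (argmaxA (λ a → f (a ∷ bestTail a)))

module Pushforward (R : Reals) where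
  open RealProperties R

  Image : ∀ {k N} → (Fin k → Fin N) → Fin N → Set
  Image ι w = ∃ λ v → ι v ≡ w

  image? : ∀ {k N} (ι : Fin k → Fin N) w → Dec (Image ι w)
  image? ι w = any? (λ v → ι v ≟ w)

  _when_ : ∀ {P : Set} → ℝ → Dec P → ℝ
  x when yes _ = x
  x when no  _ = 0#

  when-yes : ∀ {P : Set} {x} (d : Dec P) → P → x when d ≡ x
  when-yes (yes _) _ = refl
  when-yes (no ¬p) p = ⊥-elim (¬p p)

  when-no : ∀ {P : Set} {x} (d : Dec P) → ¬ P → x when d ≡ 0#
  when-no (yes p) ¬p = ⊥-elim (¬p p)
  when-no (no _)  _  = refl

  when-zero : ∀ {P : Set} {x} (d : Dec P) → x ≡ 0# → x when d ≡ 0#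
  when-zero (yes _) x≡0 = x≡0
  when-zero (no _)  _   = refl

  when-nonneg : ∀ {P : Set} {x} (d : Dec P) → 0# ≤ x → 0# ≤ x when d
  when-nonneg (yes _) 0≤x = 0≤x
  when-nonneg (no _)  _   = ≤-refl

  push : ∀ {k N} → (Fin k → Fin N) → (Fin k → ℝ) → Fin N → ℝ
  push ι f w = sum (λ v → f v when (ι v ≟ w))

  sum-push : ∀ {k N} (ι : Fin k → Fin N) f → sum (push ι f) ≡ sum f
  sum-push ι f = trans (∑-comm (λ w v → f v when (ι v ≟ w))) (sum-cong-≗ λ v →
    trans (sum-single (ι v) (λ w w≢ιv → when-no (ι v ≟ w) (λ ιv≡w → w≢ιv (sym ιv≡w))))
          (when-yes (ι v ≟ ι v) refl))

  push-image : ∀ {k N} {ι : Fin k → Fin N} f → Injective _≡_ _≡_ ι →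
               ∀ {v w} → ι v ≡ w → push ι f w ≡ f v
  push-image {ι = ι} f ι-inj {v} refl =
    trans (sum-single v (λ u u≢v → when-no (ι u ≟ ι v) (λ ιu≡ιv → u≢v (ι-inj ιu≡ιv))))
          (when-yes (ι v ≟ ι v) refl)

  push-outside : ∀ {k N} (ι : Fin k → Fin N) f {w} → ¬ Image ι w → push ι f w ≡ 0#
  push-outside ι f {w} w∉ι = sum-zero (λ v → when-no (ι v ≟ w) (λ ιv≡w → w∉ι (v , ιv≡w)))

  push-zero : ∀ {k N} (ι : Fin k → Fin N) {f} → (∀ v → f v ≡ 0#) → ∀ w → push ι f w ≡ 0#
  push-zero ι f≗0 w = sum-zero (λ v → when-zero (ι v ≟ w) (f≗0 v))

  push-nonneg : ∀ {k N} (ι : Fin k → Fin N) {f} → (∀ v → 0# ≤ f v) → ∀ w → 0# ≤ push ι f w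
  push-nonneg ι 0≤f w = sum-nonneg (λ v → when-nonneg (ι v ≟ w) (0≤f v))

  push₂ : ∀ {k N} → (Fin k → Fin N) → (Fin k → Fin k → ℝ) → Fin N → Fin N → ℝ
  push₂ ι F w w′ = push ι (λ u → push ι (F u) w′) w

  sum-push₂ : ∀ {k N} (ι : Fin k → Fin N) F →
              sum (λ w → sum (push₂ ι F w)) ≡ sum (λ u → sum (F u))
  sum-push₂ ι F = begin
    sum (λ w → sum (λ w′ → push ι (λ u → push ι (F u) w′) w)) ≡⟨ ∑-comm (push₂ ι F) ⟩
    sum (λ w′ → sum (push ι (λ u → push ι (F u) w′)))
      ≡⟨ sum-cong-≗ (λ w′ → sum-push ι (λ u → push ι (F u) w′)) ⟩
    sum (λ w′ → sum (λ u → push ι (F u) w′))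
      ≡⟨ ∑-comm (λ u w′ → push ι (F u) w′) ⟨
    sum (λ u → sum (push ι (F u)))                           ≡⟨ sum-cong-≗ (λ u → sum-push ι (F u)) ⟩
    sum (λ u → sum (F u))                                    ∎
    where open ≡-Reasoning

  push₂-image : ∀ {k N} {ι : Fin k → Fin N} F → Injective _≡_ _≡_ ι →
                ∀ {u v w w′} → ι u ≡ w → ι v ≡ w′ → push₂ ι F w w′ ≡ F u v
  push₂-image F ι-inj ιu≡w ιv≡w′ =
    trans (push-image _ ι-inj ιu≡w) (push-image (F _) ι-inj ιv≡w′)

  push₂-outside : ∀ {k N} (ι : Fin k → Fin N) F {w w′} →
                  ¬ Image ι w ⊎ ¬ Image ι w′ → push₂ ι F w w′ ≡ 0#
  push₂-outside ι F (inj₁ w∉ι)  = push-outside ι _ w∉ι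
  push₂-outside ι F (inj₂ w′∉ι) = push-zero ι (λ u → push-outside ι (F u) w′∉ι) _

  push₂-nonneg : ∀ {k N} (ι : Fin k → Fin N) {F} →
                 (∀ u v → 0# ≤ F u v) → ∀ w w′ → 0# ≤ push₂ ι F w w′
  push₂-nonneg ι 0≤F w w′ = push-nonneg ι (λ u → push-nonneg ι (0≤F u) w′) w

  -- Vertex terms are doubled because the ordered double sum meets every edge twice.
  weight : ∀ {N} → (Fin N → ℝ) → (Fin N → Fin N → ℝ) → ℝ
  weight f F = (sum f + sum f) + sum (λ u → sum (F u))

  weight-mono-≤ : ∀ {N} {f f′ : Fin N → ℝ} {F F′ : Fin N → Fin N → ℝ} →
                  (∀ w → f w ≤ f′ w) → (∀ w w′ → F w w′ ≤ F′ w w′) →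
                  weight f F ≤ weight f′ F′
  weight-mono-≤ f≤f′ F≤F′ =
    +-mono-≤ (+-mono-≤ (sum-mono-≤ f≤f′) (sum-mono-≤ f≤f′))
             (sum-mono-≤ (λ w → sum-mono-≤ (F≤F′ w)))

  weight-mono-≤-tight : ∀ {N} {f f′ : Fin N → ℝ} {F F′ : Fin N → Fin N → ℝ} →
                        (∀ w → f w ≤ f′ w) → (∀ w w′ → F w w′ ≤ F′ w w′) →
                        weight f F ≡ weight f′ F′ →
                        (∀ w → f w ≡ f′ w) × (∀ w w′ → F w w′ ≡ F′ w w′)
  weight-mono-≤-tight f≤f′ F≤F′ eq
    with +-mono-≤-tight (+-mono-≤ (sum-mono-≤ f≤f′) (sum-mono-≤ f≤f′))
                        (sum-mono-≤ (λ w → sum-mono-≤ (F≤F′ w))) eq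
  ... | vertices , edges =
    sum-mono-≤-tight f≤f′ (proj₁ (+-mono-≤-tight (sum-mono-≤ f≤f′) (sum-mono-≤ f≤f′) vertices)) ,
    λ w → sum-mono-≤-tight (F≤F′ w) (sum-mono-≤-tight (λ w → sum-mono-≤ (F≤F′ w)) edges w)

  weight-push : ∀ {k N} (ι : Fin k → Fin N) f F → weight (push ι f) (push₂ ι F) ≡ weight f F
  weight-push ι f F = cong₂ (λ a b → (a + a) + b) (sum-push ι f) (sum-push₂ ι F)

  weight-+ : ∀ {N} (f f′ : Fin N → ℝ) (F F′ : Fin N → Fin N → ℝ) →
             weight f F + weight f′ F′ ≡ weight (λ w → f w + f′ w) (λ w w′ → F w w′ + F′ w w′)
  weight-+ f f′ F F′ = begin
    ((Σf + Σf) + ΣF) + ((Σf′ + Σf′) + ΣF′)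
      ≡⟨ interchange (Σf + Σf) ΣF (Σf′ + Σf′) ΣF′ ⟩
    ((Σf + Σf) + (Σf′ + Σf′)) + (ΣF + ΣF′)
      ≡⟨ cong (_+ (ΣF + ΣF′)) (interchange Σf Σf Σf′ Σf′) ⟩
    ((Σf + Σf′) + (Σf + Σf′)) + (ΣF + ΣF′)
      ≡⟨ cong₂ (λ a b → (a + a) + b) (∑-distrib-+ f f′) ΣF+ΣF′ ⟨
    weight (λ w → f w + f′ w) (λ w w′ → F w w′ + F′ w w′) ∎
    where
    open ≡-Reasoning
    Σf Σf′ ΣF ΣF′ : ℝ
    Σf = sum f
    Σf′ = sum f′
    ΣF = sum (λ u → sum (F u))
    ΣF′ = sum (λ u → sum (F′ u))
    ΣF+ΣF′ : sum (λ u → sum (λ v → F u v + F′ u v)) ≡ ΣF + ΣF′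
    ΣF+ΣF′ = trans (sum-cong-≗ (λ u → ∑-distrib-+ (F u) (F′ u)))
                   (∑-distrib-+ (λ u → sum (F u)) (λ u → sum (F′ u)))

module PartialMaps where

  record Domain {N : ℕ} {B : Set} (M : Fin N → Maybe B) : Set where
    field
      size            : ℕ
      index           : Fin size → Fin N
      value           : Fin size → B
      index-value     : ∀ i → M (index i) ≡ just (value i)
      index-injective : Injective _≡_ _≡_ index
      index-complete  : ∀ {w b} → M w ≡ just b → ∃ λ i → index i ≡ w

  domain : ∀ {N B} (M : Fin N → Maybe B) → Domain M
  domain {zero} M = record
    { size = 0 ; index = λ () ; value = λ () ; index-value = λ ()
    ; index-injective = λ { {()} } ; index-complete = λ { {()} } }
  domain {suc N} {B} M with domain (λ w → M (suc w)) | M zero in M0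
  ... | D | nothing = record
    { size            = size
    ; index           = λ i → suc (index i)
    ; value           = value
    ; index-value     = index-value
    ; index-injective = λ eq → index-injective (suc-injective eq)
    ; index-complete  = complete }
    where
    open Domain D
    complete : ∀ {w b} → M w ≡ just b → ∃ λ i → suc (index i) ≡ w
    complete {zero} Mw≡just with () ← trans (sym M0) Mw≡just
    complete {suc w} Mw≡just = Product.map₂ (cong suc) (index-complete Mw≡just)
  ... | D | just b₀ = record
    { size            = suc size
    ; index           = index′
    ; value           = value′
    ; index-value     = λ { zero → M0 ; (suc i) → index-value i }
    ; index-injective = injective
    ; index-complete  = complete }
    where
    open Domain D
    index′ : Fin (suc size) → Fin (suc N)
    index′ zero    = zero
    index′ (suc i) = suc (index i)
    value′ : Fin (suc size) → B
    value′ zero    = b₀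
    value′ (suc i) = value i
    injective : Injective _≡_ _≡_ index′
    injective {zero}  {zero}  _  = refl
    injective {suc i} {suc j} eq = cong suc (index-injective (suc-injective eq))
    complete : ∀ {w b} → M w ≡ just b → ∃ λ i → index′ i ≡ w
    complete {zero}  _       = zero , refl
    complete {suc w} Mw≡just = Product.map suc (cong suc) (index-complete Mw≡just)

  PartialInjection : ∀ {N m} → (Fin N → Maybe (Fin m)) → Set
  PartialInjection M = ∀ w w′ b → M w ≡ just b → M w′ ≡ just b → w ≡ w′

  partialInjection? : ∀ {N m} (M : Fin N → Maybe (Fin m)) → Dec (PartialInjection M)
  partialInjection? M = all? λ w → all? λ w′ → all? λ b →
    ≡-dec _≟_ (M w) (just b) →-dec (≡-dec _≟_ (M w′) (just b) →-dec (w ≟ w′))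

  partialInjection-resp-≗ : ∀ {N m} {M M′ : Fin N → Maybe (Fin m)} →
                            (∀ w → M w ≡ M′ w) → PartialInjection M → PartialInjection M′
  partialInjection-resp-≗ M≗M′ M-inj w w′ b M′w M′w′ =
    M-inj w w′ b (trans (M≗M′ w) M′w) (trans (M≗M′ w′) M′w′)

  value-injective : ∀ {N m} {M : Fin N → Maybe (Fin m)} → PartialInjection M →
                    (D : Domain M) → Injective _≡_ _≡_ (Domain.value D)
  value-injective M-inj D {i} {j} vi≡vj =
    index-injective (M-inj (index i) (index j) (value j)
                           (trans (index-value i) (cong just vi≡vj)) (index-value j))
    where open Domain D

module MCSModelProperties (R : Reals) {X : Set} {_≼_ : Rel X 0ℓ} {s : X → Reals.ℝ R}
                          (M : IsMCSModel R _≡_ _≼_ s) where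
  open RealProperties R
  open IsMCSModel M public
  open IsPartialOrder isPartialOrder public using ()
    renaming (refl to ≼-refl; reflexive to ≼-reflexive; trans to ≼-trans; antisym to ≼-antisym)

  meet : X → X → X
  meet x y = proj₁ (A1 x y)

  meet-≼ˡ : ∀ x y → meet x y ≼ x
  meet-≼ˡ x y = proj₁ (proj₁ (proj₂ (A1 x y)))

  meet-≼ʳ : ∀ x y → meet x y ≼ y
  meet-≼ʳ x y = proj₂ (proj₁ (proj₂ (A1 x y)))

  meet-maximal : ∀ {x y z} → z ≼ x → z ≼ y → s z ≤ s (meet x y)
  meet-maximal {x} {y} {z} z≼x z≼y = proj₂ (proj₂ (A1 x y)) z (z≼x , z≼y)

  A2-meet : ∀ {x₁ x₂ x} → x₁ ≼ x → x₂ ≼ x → s x₁ + s x₂ ≤ s x + s (meet x₁ x₂)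
  A2-meet {x = x} x₁≼x x₂≼x with A2 _ _ x x₁≼x x₂≼x
  ... | _ , (x₁₂≼x₁ , x₁₂≼x₂) , A2-ineq =
    ≤-trans (x-z≤y⇒x≤y+z A2-ineq) (+-monoʳ-≤ (s x) (meet-maximal x₁₂≼x₁ x₁₂≼x₂))

module BottomLift (R : Reals) {X : Set} {_≼_ : Rel X 0ℓ} {s : X → Reals.ℝ R} where
  open RealProperties R

  -- nothing (no edge) is the bottom element; this is verbatim the edge condition of ExtSubgraph.
  _⊑_ : Rel (Maybe X) 0ℓ
  x ⊑ y = (x ≡ nothing) ⊎ (Σ X λ a → Σ X λ b → (x ≡ just a) × (y ≡ just b) × (a ≼ b))

  sizeᴹ : Maybe X → ℝ
  sizeᴹ nothing  = 0#
  sizeᴹ (just a) = s a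

  module _ (M : IsMCSModel R _≡_ _≼_ s) (s-pos : ∀ a → 0# < s a) where
    open MCSModelProperties R M

    meetᴹ : Maybe X → Maybe X → Maybe X
    meetᴹ (just a) (just b) = just (meet a b)
    meetᴹ _        _        = nothing

    ⊑-refl : ∀ x → x ⊑ x
    ⊑-refl nothing  = inj₁ refl
    ⊑-refl (just a) = inj₂ (a , a , refl , refl , ≼-refl)

    ⊑-trans : ∀ {x y z} → x ⊑ y → y ⊑ z → x ⊑ z
    ⊑-trans (inj₁ x≡nothing) _ = inj₁ x≡nothing
    ⊑-trans (inj₂ (a , b , x≡a , refl , a≼b)) (inj₂ (_ , c , refl , z≡c , b≼c)) =
      inj₂ (a , c , x≡a , z≡c , ≼-trans a≼b b≼c)

    ⊑-antisym : ∀ {x y} → x ⊑ y → y ⊑ x → x ≡ y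
    ⊑-antisym (inj₁ refl) (inj₁ refl) = refl
    ⊑-antisym (inj₂ (a , b , refl , refl , a≼b)) (inj₂ (_ , _ , refl , refl , b≼a)) =
      cong just (≼-antisym a≼b b≼a)

    sizeᴹ-nonneg : ∀ x → 0# ≤ sizeᴹ x
    sizeᴹ-nonneg nothing  = ≤-refl
    sizeᴹ-nonneg (just a) = s-nonneg a

    sizeᴹ-mono : ∀ {x y} → x ⊑ y → sizeᴹ x ≤ sizeᴹ y
    sizeᴹ-mono {y = y} (inj₁ refl)                = sizeᴹ-nonneg y
    sizeᴹ-mono (inj₂ (_ , _ , refl , refl , a≼b)) = S1 a≼b

    sizeᴹ-mono-tight : ∀ {x y} → x ⊑ y → sizeᴹ x ≡ sizeᴹ y → x ≡ y
    sizeᴹ-mono-tight {y = nothing} (inj₁ refl) _      = refl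
    sizeᴹ-mono-tight {y = just b}  (inj₁ refl) 0≡sb   = ⊥-elim (proj₂ (s-pos b) 0≡sb)
    sizeᴹ-mono-tight (inj₂ (_ , _ , refl , refl , a≼b)) sa≡sb = cong just (S2 a≼b sa≡sb)

    meetᴹ-⊑ˡ : ∀ x y → meetᴹ x y ⊑ x
    meetᴹ-⊑ˡ (just a) (just b) = inj₂ (meet a b , a , refl , refl , meet-≼ˡ a b)
    meetᴹ-⊑ˡ nothing  _        = inj₁ refl
    meetᴹ-⊑ˡ (just _) nothing  = inj₁ refl

    meetᴹ-⊑ʳ : ∀ x y → meetᴹ x y ⊑ y
    meetᴹ-⊑ʳ (just a) (just b) = inj₂ (meet a b , b , refl , refl , meet-≼ʳ a b)
    meetᴹ-⊑ʳ nothing  _        = inj₁ refl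
    meetᴹ-⊑ʳ (just _) nothing  = inj₁ refl

    meetᴹ-maximal : ∀ {x y z} → z ⊑ x → z ⊑ y → sizeᴹ z ≤ sizeᴹ (meetᴹ x y)
    meetᴹ-maximal {x} {y} (inj₁ refl) _ = sizeᴹ-nonneg (meetᴹ x y)
    meetᴹ-maximal (inj₂ (_ , _ , refl , refl , c≼a)) (inj₂ (_ , _ , refl , refl , c≼b)) =
      meet-maximal c≼a c≼b

    A2-meetᴹ : ∀ {x₁ x₂ x} → x₁ ⊑ x → x₂ ⊑ x →
               sizeᴹ x₁ + sizeᴹ x₂ ≤ sizeᴹ x + sizeᴹ (meetᴹ x₁ x₂)
    A2-meetᴹ p@(inj₁ refl) q = +-≤-+0 (sizeᴹ-mono p) (sizeᴹ-mono q) (inj₁ refl)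
    A2-meetᴹ {just _} p q@(inj₁ refl) = +-≤-+0 (sizeᴹ-mono p) (sizeᴹ-mono q) (inj₂ refl)
    A2-meetᴹ (inj₂ (_ , _ , refl , refl , a≼c)) (inj₂ (_ , _ , refl , refl , b≼c)) =
      A2-meet a≼c b≼c

    liftedModel : IsMCSModel R _≡_ _⊑_ sizeᴹ
    liftedModel = record
      { isPartialOrder = record
        { isPreorder = record
          { isEquivalence = isEquivalence
          ; reflexive     = λ { refl → ⊑-refl _ }
          ; trans         = ⊑-trans }
        ; antisym = ⊑-antisym }
      ; s-resp   = cong sizeᴹ
      ; s-nonneg = sizeᴹ-nonneg
      ; S1       = sizeᴹ-mono
      ; S2       = sizeᴹ-mono-tight
      ; A1       = λ x y → meetᴹ x y , (meetᴹ-⊑ˡ x y , meetᴹ-⊑ʳ x y) ,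
                           λ z (z⊑x , z⊑y) → meetᴹ-maximal z⊑x z⊑y
      ; A2       = λ x₁ x₂ x x₁⊑x x₂⊑x → meetᴹ x₁ x₂ , (meetᴹ-⊑ˡ x₁ x₂ , meetᴹ-⊑ʳ x₁ x₂) ,
                                         x≤y+z⇒x-z≤y (A2-meetᴹ x₁⊑x x₂⊑x) }

module Graphs (R : Reals) {ΣV ΣE : Set}
              {_≼V_ : Rel ΣV 0ℓ} {sV : ΣV → Reals.ℝ R}
              {_≼E_ : Rel ΣE 0ℓ} {sE : ΣE → Reals.ℝ R}
              (MV : IsMCSModel R _≡_ _≼V_ sV) (sV-pos : ∀ a → Reals._<_ R (Reals.0# R) (sV a))
              (ME : IsMCSModel R _≡_ _≼E_ sE) (sE-pos : ∀ a → Reals._<_ R (Reals.0# R) (sE a)) where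
  open RealProperties R
  open Pushforward R
  open PartialMaps
  open Argmax R
  open BottomLift R {_≼_ = _≼E_} {s = sE} using (_⊑_; sizeᴹ; liftedModel)
  module V = MCSModelProperties R MV
  module E = MCSModelProperties R (liftedModel ME sE-pos)

  Gr : Set
  Gr = Graph ΣV ΣE

  _⊆_ : Rel Gr 0ℓ
  _⊆_ = _⊆e_ _≼V_ _≼E_

  s : Gr → ℝ
  s = sGES R sV sE

  vertexSize : (g : Gr) → Fin (n g) → ℝ
  vertexSize g v = sV (vl g v)

  edgeSize : (g : Gr) → Fin (n g) → Fin (n g) → ℝ
  edgeSize g u v = sizeᴹ (el g u v)

  graphWeight : Gr → ℝ
  graphWeight g = weight (vertexSize g) (edgeSize g)

  sumFin≡sum : ∀ k f → sumFin R sV sE k f ≡ sum f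
  sumFin≡sum zero    f = refl
  sumFin≡sum (suc k) f = cong (f zero +_) (sumFin≡sum k (λ i → f (suc i)))

  sizeᴹ≗edgeWeight : ∀ x → sizeᴹ x ≡ edgeWeight R sV sE x
  sizeᴹ≗edgeWeight nothing  = refl
  sizeᴹ≗edgeWeight (just _) = refl

  upperEdgeSize : (g : Gr) → Fin (n g) → Fin (n g) → ℝ
  upperEdgeSize g u v = if toℕ u <ᵇ toℕ v then edgeWeight R sV sE (el g u v) else 0#

  edgeSize-split : ∀ g u v → edgeSize g u v ≡ upperEdgeSize g u v + upperEdgeSize g v u
  edgeSize-split g u v
    with toℕ u <ᵇ toℕ v | <ᵇ-reflects-< (toℕ u) (toℕ v)
       | toℕ v <ᵇ toℕ u | <ᵇ-reflects-< (toℕ v) (toℕ u)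
  ... | true  | ofʸ u<v | true  | ofʸ v<u = ⊥-elim (<-asym u<v v<u)
  ... | true  | _       | false | _       = trans (sizeᴹ≗edgeWeight (el g u v)) (sym (+-identityʳ _))
  ... | false | _       | true  | _       =
    trans (sizeᴹ≗edgeWeight (el g u v))
          (trans (cong (edgeWeight R sV sE) (Graph.sym g u v)) (sym (+-identityˡ _)))
  ... | false | ofⁿ u≮v | false | ofⁿ v≮u =
    trans (cong (λ w → sizeᴹ (el g u w)) (sym u≡v))
          (trans (cong sizeᴹ (irrefl g u)) (sym (+-identityˡ 0#)))
    where
    u≡v : u ≡ v
    u≡v = toℕ-injective (ℕ-≤-antisym (≮⇒≥ v≮u) (≮⇒≥ u≮v))

  s+s≡graphWeight : ∀ g → s g + s g ≡ graphWeight g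
  s+s≡graphWeight record { n = zero } =
    trans (+-identityˡ 0#) (sym (trans (+-identityʳ (0# + 0#)) (+-identityˡ 0#)))
  s+s≡graphWeight g@record { n = suc k } = begin
    (Σv′ + Σu′) + (Σv′ + Σu′)
      ≡⟨ cong₂ (λ a b → (a + b) + (a + b)) (sumFin≡sum (suc k) (vertexSize g)) Σu′≡Σu ⟩
    (Σv + Σu) + (Σv + Σu)     ≡⟨ interchange Σv Σu Σv Σu ⟩
    (Σv + Σv) + (Σu + Σu)     ≡⟨ cong ((Σv + Σv) +_) Σu+Σu≡Σe ⟩
    graphWeight g             ∎
    where
    open ≡-Reasoning
    Σv′ Σu′ Σv Σu : ℝ
    Σv′ = sumFin R sV sE (suc k) (vertexSize g)
    Σu′ = sumFin R sV sE (suc k) (λ u → sumFin R sV sE (suc k) (upperEdgeSize g u))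
    Σv = sum (vertexSize g)
    Σu = sum (λ u → sum (upperEdgeSize g u))
    Σu′≡Σu : Σu′ ≡ Σu
    Σu′≡Σu = trans (sumFin≡sum (suc k) (λ u → sumFin R sV sE (suc k) (upperEdgeSize g u)))
                   (sum-cong-≗ (λ u → sumFin≡sum (suc k) (upperEdgeSize g u)))
    Σu+Σu≡Σe : Σu + Σu ≡ sum (λ u → sum (edgeSize g u))
    Σu+Σu≡Σe = begin
      Σu + Σu                                          ≡⟨ cong (Σu +_) (∑-comm (upperEdgeSize g)) ⟩
      Σu + sum (λ u → sum (λ v → upperEdgeSize g v u))
        ≡⟨ ∑-distrib-+ (λ u → sum (upperEdgeSize g u)) (λ u → sum (λ v → upperEdgeSize g v u)) ⟨
      sum (λ u → sum (upperEdgeSize g u) + sum (λ v → upperEdgeSize g v u))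
        ≡⟨ sum-cong-≗ (λ u → ∑-distrib-+ (upperEdgeSize g u) (λ v → upperEdgeSize g v u)) ⟨
      sum (λ u → sum (λ v → upperEdgeSize g u v + upperEdgeSize g v u))
        ≡⟨ sum-cong-≗ (λ u → sum-cong-≗ (λ v → edgeSize-split g u v)) ⟨
      sum (λ u → sum (edgeSize g u))                   ∎

  graphWeight-≤⇒s-≤ : ∀ {g h} → graphWeight g ≤ graphWeight h → s g ≤ s h
  graphWeight-≤⇒s-≤ {g} {h} le =
    x+x≤y+y⇒x≤y (subst₂ _≤_ (sym (s+s≡graphWeight g)) (sym (s+s≡graphWeight h)) le)

  graphWeight-+-≤⇒s-+-≤ : ∀ {a b c d} → graphWeight a + graphWeight b ≤ graphWeight c + graphWeight d →
                          s a + s b ≤ s c + s d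
  graphWeight-+-≤⇒s-+-≤ {a} {b} {c} {d} le = x+x≤y+y⇒x≤y (subst₂ _≤_ (doubled a b) (doubled c d) le)
    where
    doubled : ∀ g h → graphWeight g + graphWeight h ≡ (s g + s h) + (s g + s h)
    doubled g h = trans (sym (cong₂ _+_ (s+s≡graphWeight g) (s+s≡graphWeight h)))
                        (interchange (s g) (s g) (s h) (s h))

  record _↪_ (h g : Gr) : Set where
    field
      to        : Fin (n h) → Fin (n g)
      injective : Injective _≡_ _≡_ to
      vl-≼      : ∀ v → vl h v ≼V vl g (to v)
      el-⊑      : ∀ u v → el h u v ⊑ el g (to u) (to v)

    vl-≼-at : ∀ {v w} → to v ≡ w → vl h v ≼V vl g w
    vl-≼-at {v} refl = vl-≼ v

    el-⊑-at : ∀ {u v w w′} → to u ≡ w → to v ≡ w′ → el h u v ⊑ el g w w′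
    el-⊑-at {u} {v} refl refl = el-⊑ u v

  open _↪_

  ↪-trans : ∀ {a b c} → a ↪ b → b ↪ c → a ↪ c
  ↪-trans e f = record
    { to        = λ v → to f (to e v)
    ; injective = λ eq → injective e (injective f eq)
    ; vl-≼      = λ v → V.≼-trans (vl-≼ e v) (vl-≼ f (to e v))
    ; el-⊑      = λ u v → E.≼-trans (el-⊑ e u v) (el-⊑ f (to e u) (to e v)) }

  ≅⇒↪ : ∀ {h g : Gr} → h ≅ g → h ↪ g
  ≅⇒↪ (φ , vl≡ , el≡) = record
    { to        = Inverse.to φ
    ; injective = Injection.injective (↔⇒↣ φ)
    ; vl-≼      = λ v → V.≼-reflexive (vl≡ v)
    ; el-⊑      = λ u v → E.≼-reflexive (el≡ u v) }

  ≅-refl : ∀ {g : Gr} → g ≅ g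
  ≅-refl = ↔-refl , (λ _ → refl) , (λ _ _ → refl)

  ≅-sym : ∀ {g h : Gr} → g ≅ h → h ≅ g
  ≅-sym {g} {h} (φ , vl≡ , el≡) = ↔-sym φ ,
    (λ w → sym (trans (vl≡ (from w)) (cong (vl h) (to∘from w)))) ,
    (λ u v → sym (trans (el≡ (from u) (from v)) (cong₂ (el h) (to∘from u) (to∘from v))))
    where
    open Inverse φ using (from) renaming (strictlyInverseˡ to to∘from)

  ≅-trans : ∀ {a b c : Gr} → a ≅ b → b ≅ c → a ≅ c
  ≅-trans (φ , vl≡ , el≡) (ψ , vl≡′ , el≡′) =
    ↔-trans φ ψ , (λ v → trans (vl≡ v) (vl≡′ _)) , (λ u v → trans (el≡ u v) (el≡′ _ _))

  ⊆⇒↪ : ∀ {g′ g} → g′ ⊆ g → g′ ↪ g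
  ⊆⇒↪ {g′} (h , g′≅h , (ι , vl-≼ , el-⊑)) = ↪-trans (≅⇒↪ {g′} {h} g′≅h) record
    { to = Injection.to ι ; injective = Injection.injective ι ; vl-≼ = vl-≼ ; el-⊑ = el-⊑ }

  ↪⇒⊆ : ∀ {h g} → h ↪ g → h ⊆ g
  ↪⇒⊆ {h} e = h , ≅-refl {h} , (mk↣ (injective e) , vl-≼ e , el-⊑ e)

  push-vertexSize-≤ : ∀ {h g} (e : h ↪ g) w → push (to e) (vertexSize h) w ≤ vertexSize g w
  push-vertexSize-≤ {h} e w with image? (to e) w
  ... | yes (v , ev≡w) =
    ≤-respˡ-≡ (sym (push-image (vertexSize h) (injective e) ev≡w)) (V.S1 (vl-≼-at e ev≡w))
  ... | no w∉e =
    ≤-respˡ-≡ (sym (push-outside (to e) (vertexSize h) w∉e)) (V.s-nonneg _)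

  push-edgeSize-≤ : ∀ {h g} (e : h ↪ g) w w′ → push₂ (to e) (edgeSize h) w w′ ≤ edgeSize g w w′
  push-edgeSize-≤ {h} {g} e w w′ with image? (to e) w | image? (to e) w′
  ... | yes (u , eu≡w) | yes (v , ev≡w′) =
    ≤-respˡ-≡ (sym (push₂-image (edgeSize h) (injective e) eu≡w ev≡w′))
              (E.S1 (el-⊑-at e eu≡w ev≡w′))
  ... | no w∉e | _ =
    ≤-respˡ-≡ (sym (push₂-outside (to e) (edgeSize h) (inj₁ w∉e))) (E.s-nonneg (el g w w′))
  ... | yes _ | no w′∉e =
    ≤-respˡ-≡ (sym (push₂-outside (to e) (edgeSize h) (inj₂ w′∉e))) (E.s-nonneg (el g w w′))

  ↪-graphWeight-≤ : ∀ {h g} → h ↪ g → graphWeight h ≤ graphWeight g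
  ↪-graphWeight-≤ {h} {g} e = subst (_≤ graphWeight g) (weight-push (to e) (vertexSize h) (edgeSize h))
    (weight-mono-≤ (push-vertexSize-≤ e) (push-edgeSize-≤ e))

  -- An embedding that preserves the weight hits every vertex, since vertex sizes are positive.
  ↪-graphWeight-tight : ∀ {h g} → h ↪ g → graphWeight h ≡ graphWeight g → h ≅ g
  ↪-graphWeight-tight {h} {g} e eq =
    ι↔ , (λ v → V.S2 (vl-≼ e v) (vertexSize≡ v)) , (λ u v → E.S2 (el-⊑ e u v) (edgeSize≡ u v))
    where
    ι : Fin (n h) → Fin (n g)
    ι = to e
    pointwise : (∀ w → push ι (vertexSize h) w ≡ vertexSize g w) ×
                (∀ w w′ → push₂ ι (edgeSize h) w w′ ≡ edgeSize g w w′)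
    pointwise = weight-mono-≤-tight (push-vertexSize-≤ e) (push-edgeSize-≤ e)
                  (trans (weight-push ι (vertexSize h) (edgeSize h)) eq)
    vertexSize≡ : ∀ v → vertexSize h v ≡ vertexSize g (ι v)
    vertexSize≡ v = trans (sym (push-image (vertexSize h) (injective e) refl)) (proj₁ pointwise (ι v))
    edgeSize≡ : ∀ u v → edgeSize h u v ≡ edgeSize g (ι u) (ι v)
    edgeSize≡ u v =
      trans (sym (push₂-image (edgeSize h) (injective e) refl refl)) (proj₂ pointwise (ι u) (ι v))
    surjective : ∀ w → Image ι w
    surjective w with image? ι w
    ... | yes w∈ι = w∈ι
    ... | no w∉ι  = ⊥-elim (proj₂ (sV-pos (vl g w))
                      (trans (sym (push-outside ι (vertexSize h) w∉ι)) (proj₁ pointwise w)))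
    ι↔ : Fin (n h) ↔ Fin (n g)
    ι↔ = mk↔ₛ′ ι (λ w → proj₁ (surjective w)) (λ w → proj₂ (surjective w))
               (λ v → injective e (proj₂ (surjective (ι v))))

  emptyGraph : Gr
  emptyGraph = record { n = 0 ; vl = λ () ; el = λ () ; sym = λ () ; irrefl = λ () }

  emptyGraph-↪ : ∀ g → emptyGraph ↪ g
  emptyGraph-↪ g = record { to = λ () ; injective = λ { {()} } ; vl-≼ = λ () ; el-⊑ = λ () }

  meetGraph : (g₁ g₂ : Gr) {k : ℕ} → (Fin k → Fin (n g₁)) → (Fin k → Fin (n g₂)) → Gr
  meetGraph g₁ g₂ {k} p₁ p₂ = record
    { n      = k
    ; vl     = λ i → V.meet (vl g₁ (p₁ i)) (vl g₂ (p₂ i))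
    ; el     = λ i j → E.meet (el g₁ (p₁ i) (p₁ j)) (el g₂ (p₂ i) (p₂ j))
    ; sym    = λ i j → cong₂ E.meet (Graph.sym g₁ (p₁ i) (p₁ j)) (Graph.sym g₂ (p₂ i) (p₂ j))
    ; irrefl = λ i → cong₂ E.meet (irrefl g₁ (p₁ i)) (irrefl g₂ (p₂ i)) }

  meetGraph-↪ˡ : ∀ g₁ g₂ {k} (p₁ : Fin k → Fin (n g₁)) (p₂ : Fin k → Fin (n g₂)) →
                 Injective _≡_ _≡_ p₁ → meetGraph g₁ g₂ p₁ p₂ ↪ g₁
  meetGraph-↪ˡ g₁ g₂ p₁ p₂ p₁-inj = record
    { to   = p₁
    ; injective = p₁-inj
    ; vl-≼ = λ i → V.meet-≼ˡ (vl g₁ (p₁ i)) (vl g₂ (p₂ i))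
    ; el-⊑ = λ i j → E.meet-≼ˡ (el g₁ (p₁ i) (p₁ j)) (el g₂ (p₂ i) (p₂ j)) }

  meetGraph-↪ʳ : ∀ g₁ g₂ {k} (p₁ : Fin k → Fin (n g₁)) (p₂ : Fin k → Fin (n g₂)) →
                 Injective _≡_ _≡_ p₂ → meetGraph g₁ g₂ p₁ p₂ ↪ g₂
  meetGraph-↪ʳ g₁ g₂ p₁ p₂ p₂-inj = record
    { to   = p₂
    ; injective = p₂-inj
    ; vl-≼ = λ i → V.meet-≼ʳ (vl g₁ (p₁ i)) (vl g₂ (p₂ i))
    ; el-⊑ = λ i j → E.meet-≼ʳ (el g₁ (p₁ i) (p₁ j)) (el g₂ (p₂ i) (p₂ j)) }

  module Intersection {x₁ x₂ x : Gr} (e₁ : x₁ ↪ x) (e₂ : x₂ ↪ x) where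

    bothPreimages : Fin (n x) → Maybe (Fin (n x₁) × Fin (n x₂))
    bothPreimages w with image? (to e₁) w | image? (to e₂) w
    ... | yes (v₁ , _) | yes (v₂ , _) = just (v₁ , v₂)
    ... | _            | _            = nothing

    bothPreimages-just : ∀ {w v₁ v₂} → bothPreimages w ≡ just (v₁ , v₂) →
                         to e₁ v₁ ≡ w × to e₂ v₂ ≡ w
    bothPreimages-just {w} eq with image? (to e₁) w | image? (to e₂) w
    bothPreimages-just refl | yes (_ , e₁v₁≡w) | yes (_ , e₂v₂≡w) = e₁v₁≡w , e₂v₂≡w
    bothPreimages-just ()   | yes _            | no _
    bothPreimages-just ()   | no _             | _

    bothPreimages-defined : ∀ {w} → Image (to e₁) w → Image (to e₂) w →
                            ∃ λ p → bothPreimages w ≡ just p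
    bothPreimages-defined {w} w∈e₁ w∈e₂ with image? (to e₁) w | image? (to e₂) w
    ... | yes (v₁ , _) | yes (v₂ , _) = (v₁ , v₂) , refl
    ... | no w∉e₁      | _            = ⊥-elim (w∉e₁ w∈e₁)
    ... | yes _        | no w∉e₂      = ⊥-elim (w∉e₂ w∈e₂)

    open Domain (domain bothPreimages)

    p₁ : Fin size → Fin (n x₁)
    p₁ i = proj₁ (value i)

    p₂ : Fin size → Fin (n x₂)
    p₂ i = proj₂ (value i)

    e₁p₁≡index : ∀ i → to e₁ (p₁ i) ≡ index i
    e₁p₁≡index i = proj₁ (bothPreimages-just (index-value i))

    e₂p₂≡index : ∀ i → to e₂ (p₂ i) ≡ index i
    e₂p₂≡index i = proj₂ (bothPreimages-just (index-value i))

    missed : ∀ {w} → ¬ Image index w → ¬ Image (to e₁) w ⊎ ¬ Image (to e₂) w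
    missed {w} w∉index with image? (to e₁) w | image? (to e₂) w
    ... | yes w∈e₁ | yes w∈e₂ =
      ⊥-elim (w∉index (index-complete (proj₂ (bothPreimages-defined w∈e₁ w∈e₂))))
    ... | no w∉e₁  | _        = inj₁ w∉e₁
    ... | yes _    | no w∉e₂  = inj₂ w∉e₂

    x₁₂ : Gr
    x₁₂ = meetGraph x₁ x₂ p₁ p₂

    x₁₂-↪ˡ : x₁₂ ↪ x₁
    x₁₂-↪ˡ = meetGraph-↪ˡ x₁ x₂ p₁ p₂ λ {i} {j} p₁i≡p₁j →
      index-injective (trans (sym (e₁p₁≡index i)) (trans (cong (to e₁) p₁i≡p₁j) (e₁p₁≡index j)))

    x₁₂-↪ʳ : x₁₂ ↪ x₂
    x₁₂-↪ʳ = meetGraph-↪ʳ x₁ x₂ p₁ p₂ λ {i} {j} p₂i≡p₂j →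
      index-injective (trans (sym (e₂p₂≡index i)) (trans (cong (to e₂) p₂i≡p₂j) (e₂p₂≡index j)))

    vertexSize-A2 : ∀ w → push (to e₁) (vertexSize x₁) w + push (to e₂) (vertexSize x₂) w
                          ≤ vertexSize x w + push index (vertexSize x₁₂) w
    vertexSize-A2 w with image? index w
    ... | yes (i , refl) = subst₂ _≤_
      (sym (cong₂ _+_ (push-image (vertexSize x₁) (injective e₁) (e₁p₁≡index i))
                      (push-image (vertexSize x₂) (injective e₂) (e₂p₂≡index i))))
      (sym (cong (vertexSize x (index i) +_) (push-image (vertexSize x₁₂) index-injective refl)))
      (V.A2-meet (vl-≼-at e₁ (e₁p₁≡index i)) (vl-≼-at e₂ (e₂p₂≡index i)))
    ... | no w∉index =
      ≤-respʳ-≡ (cong (vertexSize x w +_) (sym (push-outside index (vertexSize x₁₂) w∉index)))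
        (+-≤-+0 (push-vertexSize-≤ e₁ w) (push-vertexSize-≤ e₂ w)
                (Sum.map (push-outside (to e₁) (vertexSize x₁)) (push-outside (to e₂) (vertexSize x₂))
                         (missed w∉index)))

    edgeSize-A2-offDomain : ∀ {w w′} → ¬ Image index w ⊎ ¬ Image index w′ →
                            push₂ (to e₁) (edgeSize x₁) w w′ + push₂ (to e₂) (edgeSize x₂) w w′
                            ≤ edgeSize x w w′ + push₂ index (edgeSize x₁₂) w w′
    edgeSize-A2-offDomain {w} {w′} off =
      ≤-respʳ-≡ (cong (edgeSize x w w′ +_) (sym (push₂-outside index (edgeSize x₁₂) off)))
        (+-≤-+0 (push-edgeSize-≤ e₁ w w′) (push-edgeSize-≤ e₂ w w′)
                (Sum.map (push₂-outside (to e₁) (edgeSize x₁)) (push₂-outside (to e₂) (edgeSize x₂))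
                         (Sum.[ Sum.map inj₁ inj₁ ∘ missed , Sum.map inj₂ inj₂ ∘ missed ] off)))

    edgeSize-A2 : ∀ w w′ → push₂ (to e₁) (edgeSize x₁) w w′ + push₂ (to e₂) (edgeSize x₂) w w′
                           ≤ edgeSize x w w′ + push₂ index (edgeSize x₁₂) w w′
    edgeSize-A2 w w′ with image? index w | image? index w′
    ... | yes (i , refl) | yes (j , refl) = subst₂ _≤_
      (sym (cong₂ _+_ (push₂-image (edgeSize x₁) (injective e₁) (e₁p₁≡index i) (e₁p₁≡index j))
                      (push₂-image (edgeSize x₂) (injective e₂) (e₂p₂≡index i) (e₂p₂≡index j))))
      (sym (cong (edgeSize x (index i) (index j) +_)
                 (push₂-image (edgeSize x₁₂) index-injective refl refl)))
      (E.A2-meet (el-⊑-at e₁ (e₁p₁≡index i) (e₁p₁≡index j))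
                 (el-⊑-at e₂ (e₂p₂≡index i) (e₂p₂≡index j)))
    ... | no w∉index | _           = edgeSize-A2-offDomain (inj₁ w∉index)
    ... | yes _      | no w′∉index = edgeSize-A2-offDomain (inj₂ w′∉index)

    graphWeight-A2 : graphWeight x₁ + graphWeight x₂ ≤ graphWeight x + graphWeight x₁₂
    graphWeight-A2 = subst₂ _≤_ pushed₁+pushed₂ x+pushed₁₂ (weight-mono-≤ vertexSize-A2 edgeSize-A2)
      where
      pushed₁+pushed₂ :
        weight (λ w → push (to e₁) (vertexSize x₁) w + push (to e₂) (vertexSize x₂) w)
               (λ w w′ → push₂ (to e₁) (edgeSize x₁) w w′ + push₂ (to e₂) (edgeSize x₂) w w′)
        ≡ graphWeight x₁ + graphWeight x₂
      pushed₁+pushed₂ =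
        trans (sym (weight-+ (push (to e₁) (vertexSize x₁)) (push (to e₂) (vertexSize x₂))
                             (push₂ (to e₁) (edgeSize x₁)) (push₂ (to e₂) (edgeSize x₂))))
              (cong₂ _+_ (weight-push (to e₁) (vertexSize x₁) (edgeSize x₁))
                         (weight-push (to e₂) (vertexSize x₂) (edgeSize x₂)))
      x+pushed₁₂ : weight (λ w → vertexSize x w + push index (vertexSize x₁₂) w)
                          (λ w w′ → edgeSize x w w′ + push₂ index (edgeSize x₁₂) w w′)
                   ≡ graphWeight x + graphWeight x₁₂
      x+pushed₁₂ =
        trans (sym (weight-+ (vertexSize x) (push index (vertexSize x₁₂))
                             (edgeSize x) (push₂ index (edgeSize x₁₂))))
              (cong (graphWeight x +_) (weight-push index (vertexSize x₁₂) (edgeSize x₁₂)))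

  module CommonSubgraphs (x₁ x₂ : Gr) where

    PartialMap : Set
    PartialMap = Fin (n x₁) → Maybe (Fin (n x₂))

    meetGraphOn : PartialMap → Gr
    meetGraphOn M = meetGraph x₁ x₂ index value
      where open Domain (domain M)

    candidate : (M : PartialMap) → Dec (PartialInjection M) → Gr
    candidate M (yes _) = meetGraphOn M
    candidate M (no _)  = emptyGraph

    candidate-↪ˡ : ∀ {M} (d : Dec (PartialInjection M)) → candidate M d ↪ x₁
    candidate-↪ˡ {M} (yes _) = meetGraph-↪ˡ x₁ x₂ _ _ (Domain.index-injective (domain M))
    candidate-↪ˡ     (no _)  = emptyGraph-↪ x₁

    candidate-↪ʳ : ∀ {M} (d : Dec (PartialInjection M)) → candidate M d ↪ x₂
    candidate-↪ʳ {M} (yes M-inj) = meetGraph-↪ʳ x₁ x₂ _ _ (value-injective M-inj (domain M))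
    candidate-↪ʳ     (no _)      = emptyGraph-↪ x₂

    module _ {y : Gr} (e₁ : y ↪ x₁) (e₂ : y ↪ x₂) where

      module _ (M : PartialMap) (extends : ∀ v → M (to e₁ v) ≡ just (to e₂ v)) where
        open Domain (domain M)

        matched : ∀ v → ∃ λ i → index i ≡ to e₁ v × value i ≡ to e₂ v
        matched v with index-complete (extends v)
        ... | i , index≡ =
          i , index≡ , just-injective (trans (sym (index-value i)) (trans (cong M index≡) (extends v)))

        vertexSize-dominated : ∀ w → push (to e₁) (vertexSize y) w ≤ push index (vertexSize (meetGraphOn M)) w
        vertexSize-dominated w with image? (to e₁) w
        ... | no w∉e₁ = ≤-respˡ-≡ (sym (push-outside (to e₁) (vertexSize y) w∉e₁))
                          (push-nonneg index (λ i → V.s-nonneg _) w)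
        ... | yes (v , refl) with matched v
        ...   | i , index≡ , value≡ =
          subst₂ _≤_ (sym (push-image (vertexSize y) (injective e₁) refl))
                     (sym (push-image (vertexSize (meetGraphOn M)) index-injective index≡))
                     (V.meet-maximal (vl-≼-at e₁ (sym index≡)) (vl-≼-at e₂ (sym value≡)))

        edgeSize-dominated : ∀ w w′ → push₂ (to e₁) (edgeSize y) w w′
                                      ≤ push₂ index (edgeSize (meetGraphOn M)) w w′
        edgeSize-dominated w w′ with image? (to e₁) w | image? (to e₁) w′
        ... | no w∉e₁ | _ =
          ≤-respˡ-≡ (sym (push₂-outside (to e₁) (edgeSize y) (inj₁ w∉e₁)))
                    (push₂-nonneg index (λ i j → E.s-nonneg (el (meetGraphOn M) i j)) w w′)
        ... | yes _ | no w′∉e₁ =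
          ≤-respˡ-≡ (sym (push₂-outside (to e₁) (edgeSize y) (inj₂ w′∉e₁)))
                    (push₂-nonneg index (λ i j → E.s-nonneg (el (meetGraphOn M) i j)) w w′)
        ... | yes (u , refl) | yes (v , refl) with matched u | matched v
        ...   | i , index≡ᵢ , value≡ᵢ | j , index≡ⱼ , value≡ⱼ =
          subst₂ _≤_ (sym (push₂-image (edgeSize y) (injective e₁) refl refl))
                     (sym (push₂-image (edgeSize (meetGraphOn M)) index-injective index≡ᵢ index≡ⱼ))
                     (E.meet-maximal (el-⊑-at e₁ (sym index≡ᵢ) (sym index≡ⱼ))
                                     (el-⊑-at e₂ (sym value≡ᵢ) (sym value≡ⱼ)))

        meetGraphOn-dominates : graphWeight y ≤ graphWeight (meetGraphOn M)
        meetGraphOn-dominates = subst₂ _≤_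
          (weight-push (to e₁) (vertexSize y) (edgeSize y))
          (weight-push index (vertexSize (meetGraphOn M)) (edgeSize (meetGraphOn M)))
          (weight-mono-≤ vertexSize-dominated edgeSize-dominated)

      induced : PartialMap
      induced w with image? (to e₁) w
      ... | yes (v , _) = just (to e₂ v)
      ... | no _        = nothing

      induced-extends : ∀ v → induced (to e₁ v) ≡ just (to e₂ v)
      induced-extends v with image? (to e₁) (to e₁ v)
      ... | yes (v′ , e₁v′≡e₁v) = cong (just ∘ to e₂) (injective e₁ e₁v′≡e₁v)
      ... | no v∉e₁            = ⊥-elim (v∉e₁ (v , refl))

      induced-injective : PartialInjection induced
      induced-injective w w′ b induced-w induced-w′ with image? (to e₁) w | image? (to e₁) w′
      induced-injective _ _ _ refl e₂v′≡e₂v | yes (v , refl) | yes (v′ , refl) =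
        cong (to e₁) (injective e₂ (just-injective (sym e₂v′≡e₂v)))
      induced-injective _ _ _ () _ | no _  | _
      induced-injective _ _ _ _ () | yes _ | no _

    candidateWeight : Vec (Maybe (Fin (n x₂))) (n x₁) → ℝ
    candidateWeight M = graphWeight (candidate (lookup M) (partialInjection? (lookup M)))

    bestCandidate : Σ (Vec (Maybe (Fin (n x₂))) (n x₁)) λ M* →
                      ∀ M → candidateWeight M ≤ candidateWeight M*
    bestCandidate = vec-hasArgmax (n x₁) (maybeFin-hasArgmax (n x₂)) candidateWeight

    largest : Gr
    largest = candidate (lookup (proj₁ bestCandidate)) (partialInjection? (lookup (proj₁ bestCandidate)))

    largest-↪ˡ : largest ↪ x₁
    largest-↪ˡ = candidate-↪ˡ (partialInjection? (lookup (proj₁ bestCandidate)))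

    largest-↪ʳ : largest ↪ x₂
    largest-↪ʳ = candidate-↪ʳ (partialInjection? (lookup (proj₁ bestCandidate)))

    largest-maximal : ∀ {y} → y ↪ x₁ → y ↪ x₂ → graphWeight y ≤ graphWeight largest
    largest-maximal {y} e₁ e₂ =
      ≤-trans (viaCandidate (partialInjection? M)) (proj₂ bestCandidate (tabulate (induced e₁ e₂)))
      where
      M : PartialMap
      M = lookup (tabulate (induced e₁ e₂))
      M≗induced : ∀ w → M w ≡ induced e₁ e₂ w
      M≗induced = lookup∘tabulate (induced e₁ e₂)
      viaCandidate : (d : Dec (PartialInjection M)) → graphWeight y ≤ graphWeight (candidate M d)
      viaCandidate (yes _) =
        meetGraphOn-dominates e₁ e₂ M (λ v → trans (M≗induced (to e₁ v)) (induced-extends e₁ e₂ v))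
      viaCandidate (no ¬inj) =
        ⊥-elim (¬inj (partialInjection-resp-≗ (sym ∘ M≗induced) (induced-injective e₁ e₂)))

  ≅⇒⊆ : ∀ {g h} → g ≅ h → g ⊆ h
  ≅⇒⊆ {g} {h} g≅h = ↪⇒⊆ (≅⇒↪ {g} {h} g≅h)

  ⊆-trans : ∀ {a b c} → a ⊆ b → b ⊆ c → a ⊆ c
  ⊆-trans {a} {b} {c} a⊆b b⊆c = ↪⇒⊆ (↪-trans (⊆⇒↪ {a} {b} a⊆b) (⊆⇒↪ {b} {c} b⊆c))

  s-mono : ∀ {g h} → g ⊆ h → s g ≤ s h
  s-mono {g} {h} g⊆h = graphWeight-≤⇒s-≤ {g} {h} (↪-graphWeight-≤ (⊆⇒↪ {g} {h} g⊆h))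

  s-mono-tight : ∀ {g h} → g ⊆ h → s g ≡ s h → g ≅ h
  s-mono-tight {g} {h} g⊆h sg≡sh = ↪-graphWeight-tight (⊆⇒↪ {g} {h} g⊆h)
    (trans (sym (s+s≡graphWeight g)) (trans (cong₂ _+_ sg≡sh sg≡sh) (s+s≡graphWeight h)))

  ⊆-antisym : ∀ {g h} → g ⊆ h → h ⊆ g → g ≅ h
  ⊆-antisym {g} {h} g⊆h h⊆g =
    s-mono-tight {g} {h} g⊆h (≤-antisym (s-mono {g} {h} g⊆h) (s-mono {h} {g} h⊆g))

  s-resp-≅ : ∀ {g h} → g ≅ h → s g ≡ s h
  s-resp-≅ {g} {h} g≅h =
    ≤-antisym (s-mono {g} {h} (≅⇒⊆ {g} {h} g≅h)) (s-mono {h} {g} (≅⇒⊆ {h} {g} (≅-sym {g} {h} g≅h)))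

  s-nonneg : ∀ g → 0# ≤ s g
  s-nonneg g = s-mono {emptyGraph} {g} (↪⇒⊆ (emptyGraph-↪ g))

  s-A1 : ∀ x₁ x₂ → Σ Gr λ m → CS R _⊆_ x₁ x₂ m × (∀ y → CS R _⊆_ x₁ x₂ y → s y ≤ s m)
  s-A1 x₁ x₂ = largest , (↪⇒⊆ largest-↪ˡ , ↪⇒⊆ largest-↪ʳ) , λ y (y⊆x₁ , y⊆x₂) →
    graphWeight-≤⇒s-≤ {y} {largest}
      (largest-maximal (⊆⇒↪ {y} {x₁} y⊆x₁) (⊆⇒↪ {y} {x₂} y⊆x₂))
    where open CommonSubgraphs x₁ x₂

  s-A2 : ∀ x₁ x₂ x → x₁ ⊆ x → x₂ ⊆ x →
         Σ Gr λ x₁₂ → CS R _⊆_ x₁ x₂ x₁₂ × (s x₁ + s x₂ - s x₁₂ ≤ s x)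
  s-A2 x₁ x₂ x x₁⊆x x₂⊆x = x₁₂ , (↪⇒⊆ x₁₂-↪ˡ , ↪⇒⊆ x₁₂-↪ʳ) ,
    x≤y+z⇒x-z≤y (graphWeight-+-≤⇒s-+-≤ {x₁} {x₂} {x} {x₁₂} graphWeight-A2)
    where open Intersection (⊆⇒↪ {x₁} {x} x₁⊆x) (⊆⇒↪ {x₂} {x} x₂⊆x)

theorem4 : (R : Reals) {ΣV ΣE : Set}
           (_≼V_ : Rel ΣV 0ℓ) (sV : ΣV → Reals.ℝ R)
           (_≼E_ : Rel ΣE 0ℓ) (sE : ΣE → Reals.ℝ R) →
           IsMCSModel R _≡_ _≼V_ sV → (∀ a → Reals._<_ R (Reals.0# R) (sV a)) →
           IsMCSModel R _≡_ _≼E_ sE → (∀ a → Reals._<_ R (Reals.0# R) (sE a)) →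
           IsMCSModel R _≅_ (_⊆e_ _≼V_ _≼E_) (sGES R sV sE)
theorem4 R _≼V_ sV _≼E_ sE MV sV-pos ME sE-pos = record
  { isPartialOrder = record
    { isPreorder = record
      { isEquivalence = record
        { refl  = λ {g} → ≅-refl {g}
        ; sym   = λ {g h} → ≅-sym {g} {h}
        ; trans = λ {a b c} → ≅-trans {a} {b} {c} }
      ; reflexive = λ {g h} → ≅⇒⊆ {g} {h}
      ; trans     = λ {a b c} → ⊆-trans {a} {b} {c} }
    ; antisym = λ {g h} → ⊆-antisym {g} {h} }
  ; s-resp   = λ {g h} → s-resp-≅ {g} {h}
  ; s-nonneg = s-nonneg
  ; S1       = λ {g h} → s-mono {g} {h}
  ; S2       = λ {g h} → s-mono-tight {g} {h}
  ; A1       = s-A1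
  ; A2       = s-A2 }
  where open Graphs R MV sV-pos ME sE-pos
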